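{- Let $Q$ be an $\mathcal{E}_s$ process and let $U_0=a[U]\parallel A$ be an $\mathcal{E}_s$ update pattern, where $A$ is a term of the category $A$ of the $\mathcal E_s$ grammar. Then $$\mathrm{CStr}(a[Q])=\mathrm{CStr}(a[U\{Q\}]\parallel A)\ \wedge\ (\mathrm{numph}(U)>0\Rightarrow\mathrm{numap}(Q)=0)$$ holds if and only if one of the following holds: (0) $\mathrm{numholes}(U)=0$ and $\mathrm{CStr}(Q)=\mathrm{CStr}(U)$; (1) $\mathrm{numholes}(U)=1$, $\mathrm{numap}(U)=0$ and $(\mathrm{numph}(U)>0\Rightarrow\mathrm{numap}(Q)=0)$; (2) $\mathrm{numholes}(U)>1$, $\mathrm{numap}(U)=0$ and $\mathrm{numap}(Q)=0$.
   Context: Fix a countably infinite set $\mathcal N$ of names. Prefixes $\pi ::= a \mid \overline{a} \mid \widetilde{a}\{U\}$. $\mathcal E_s$ processes are generated by $P::=a[P]\mid P\parallel P\mid A$, $A ::= A\parallel A\mid\ !\pi.A\mid \sum_{i\in I}\pi_i.A_i$ ($I$ finite), $\pi::= a\mid\overline a\mid \widetilde a\{a[U]\parallel A\}$; $\mathcal E_s$ update patterns are generated by the same grammar with a hole $\bullet$ added to both categories $P$ and $A$. $U\{Q\}$: $\bullet\{Q\}=Q$, $a[U]\{Q\}=a[U\{Q\}]$, homomorphic on $\parallel$, $(\sum_i\pi_i.U_i)\{Q\}=\sum_i\pi_i.(U_i\{Q\})$, $(!\pi.U)\{Q\}=!\pi.(U\{Q\})$ (holes inside update prefixes not filled). $\mathrm{numap}(\bullet)=0$,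 $\mathrm{numap}(a[U])=1+\mathrm{numap}(U)$, $\mathrm{numap}(U_1\parallel U_2)=\mathrm{numap}(U_1)+\mathrm{numap}(U_2)$, $\mathrm{numap}(\sum_i\pi_i.U_i)=\mathrm{numap}(!\pi.U)=0$. $\mathrm{numholes}(\bullet)=1$, $\mathrm{numholes}(a[U])=\mathrm{numholes}(U)$, additive on $\parallel$, $\mathrm{numholes}(\sum_i\pi_i.U_i)=\sum_i\mathrm{numholes}(U_i)$, $\mathrm{numholes}(!\pi.U)=\mathrm{numholes}(U)$. $\mathrm{numph}(\bullet)=0$, $\mathrm{numph}(a[U])=\mathrm{numph}(U)$, additive on $\parallel$, $\mathrm{numph}(\sum_i\pi_i.U_i)=\sum_i\mathrm{numholes}(U_i)$, $\mathrm{numph}(!\pi.U)=\mathrm{numholes}(U)$. Writing a term up to commutativity/associativity of $\parallel$ as $\prod_{i=1}^m P_i\parallel\prod_{j=1}^n a_j[P'_j]$ with each $P_i$ neither a parallel composition nor located, its containment structure $\mathrm{CStr}$ is the unordered rooted tree with root labelled $\epsilon$ whose children are the roots of $\mathrm{CStr}(P'_1),\dots,\mathrm{CStr}(P'_n)$ relabelled $a_1,\dots,a_n$. -}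

module Defs where

open import Data.Nat using (ℕ; zero; suc; _+_)
open import Data.List using (List; []; _∷_; _++_)
open import Data.Product using (_×_; _,_)
open import Relation.Binary.PropositionalEquality using (_≡_)

Name : Set
Name = ℕ

-- E_s syntax
--   P ::= a[P] | P ∥ P | A
--   A ::= A ∥ A | !π.A | Σ_{i∈I} π_i.A_i      (I finite: a list)
--   π ::= a | ā | ã{a[U] ∥ A}
-- Update patterns: same grammar with a hole • in both categories.

mutual
  data Prefix : Set where
    inp : Name → Prefix
    out : Name → Prefix
    upd : Name → Pat → AProc → Prefix

  data Proc : Set where
    loc : Name → Proc → Proc
    par : Proc → Proc → Proc
    act : AProc → Proc

  data AProc : Set where
    apar : AProc → AProc → AProc
    repl : Prefix → AProc → AProc
    sum  : List (Prefix × AProc) → AProc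

  data Pat : Set where
    hole : Pat
    ploc : Name → Pat → Pat
    ppar : Pat → Pat → Pat
    pact : APat → Pat

  data APat : Set where
    ahole : APat
    apar  : APat → APat → APat
    repl  : Prefix → APat → APat
    sum   : List (Prefix × APat) → APat

-- General terms (possibly with holes), the common target of processes,
-- patterns and fillings U{Q} (which in general leave the E_s grammar,
-- e.g. a located process under a prefix).

data Term : Set where
  hole : Term
  loc  : Name → Term → Term
  par  : Term → Term → Term
  repl : Prefix → Term → Term
  sum  : List (Prefix × Term) → Term

mutual
  ⌜_⌝P : Proc → Term
  ⌜ loc a P ⌝P = loc a ⌜ P ⌝P
  ⌜ par P R ⌝P = par ⌜ P ⌝P ⌜ R ⌝P
  ⌜ act A ⌝P   = ⌜ A ⌝A

  ⌜_⌝A : AProc → Term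
  ⌜ apar A B ⌝A = par ⌜ A ⌝A ⌜ B ⌝A
  ⌜ repl π A ⌝A = repl π ⌜ A ⌝A
  ⌜ sum xs ⌝A   = sum (embA-list xs)

  embA-list : List (Prefix × AProc) → List (Prefix × Term)
  embA-list []             = []
  embA-list ((π , A) ∷ xs) = (π , ⌜ A ⌝A) ∷ embA-list xs

mutual
  ⌜_⌝U : Pat → Term
  ⌜ hole ⌝U     = hole
  ⌜ ploc a U ⌝U = loc a ⌜ U ⌝U
  ⌜ ppar U V ⌝U = par ⌜ U ⌝U ⌜ V ⌝U
  ⌜ pact A ⌝U   = ⌜ A ⌝AU

  ⌜_⌝AU : APat → Term
  ⌜ ahole ⌝AU    = hole
  ⌜ apar A B ⌝AU = par ⌜ A ⌝AU ⌜ B ⌝AU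
  ⌜ repl π A ⌝AU = repl π ⌜ A ⌝AU
  ⌜ sum xs ⌝AU   = sum (embAU-list xs)

  embAU-list : List (Prefix × APat) → List (Prefix × Term)
  embAU-list []             = []
  embAU-list ((π , A) ∷ xs) = (π , ⌜ A ⌝AU) ∷ embAU-list xs

-- Filling U{Q} (holes inside update prefixes are not filled).

mutual
  fill : Pat → Proc → Term
  fill hole       Q = ⌜ Q ⌝P
  fill (ploc a U) Q = loc a (fill U Q)
  fill (ppar U V) Q = par (fill U Q) (fill V Q)
  fill (pact A)   Q = fillA A Q

  fillA : APat → Proc → Term
  fillA ahole      Q = ⌜ Q ⌝P
  fillA (apar A B) Q = par (fillA A Q) (fillA B Q)
  fillA (repl π A) Q = repl π (fillA A Q)
  fillA (sum xs)   Q = sum (fill-list xs Q)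

  fill-list : List (Prefix × APat) → Proc → List (Prefix × Term)
  fill-list []             Q = []
  fill-list ((π , A) ∷ xs) Q = (π , fillA A Q) ∷ fill-list xs Q

_⟨_⟩ : Pat → Proc → Term
U ⟨ Q ⟩ = fill U Q

numap : Term → ℕ
numap hole      = 0
numap (loc a t) = suc (numap t)
numap (par t u) = numap t + numap u
numap (repl π t) = 0
numap (sum xs)  = 0

mutual
  numholes : Term → ℕ
  numholes hole       = 1
  numholes (loc a t)  = numholes t
  numholes (par t u)  = numholes t + numholes u
  numholes (repl π t) = numholes t
  numholes (sum xs)   = numholes-list xs

  numholes-list : List (Prefix × Term) → ℕ
  numholes-list []             = 0
  numholes-list ((π , t) ∷ xs) = numholes t + numholes-list xs

numph : Term → ℕ
numph hole       = 0
numph (loc a t)  = numph t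
numph (par t u)  = numph t + numph u
numph (repl π t) = numholes t
numph (sum xs)   = numholes-list xs

-- Containment structure: unordered rooted trees with name-labelled
-- children (root labelled ε).

data CTree : Set where
  node : List (Name × CTree) → CTree

children : Term → List (Name × CTree)
children hole       = []
children (loc a t)  = (a , node (children t)) ∷ []
children (par t u)  = children t ++ children u
children (repl π t) = []
children (sum xs)   = []

CStr : Term → CTree
CStr t = node (children t)

mutual
  data _≈T_ : CTree → CTree → Set where
    node : ∀ {xs ys} → xs ≈L ys → node xs ≈T node ys

  data _≈L_ : List (Name × CTree) → List (Name × CTree) → Set where
    []    : [] ≈L []
    cons  : ∀ {a b t u xs ys} → a ≡ b → t ≈T u → xs ≈L ys →
            ((a , t) ∷ xs) ≈L ((b , u) ∷ ys)
    swap  : ∀ {x y xs} → (x ∷ y ∷ xs) ≈L (y ∷ x ∷ xs)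
    trans : ∀ {xs ys zs} → xs ≈L ys → ys ≈L zs → xs ≈L zs

module Submission where

-- Filling a pattern U with Q is plugging the embedding of Q
-- into the top-level holes of the embedded pattern (holes under a prefix
-- are never reached).  So numholes U = top U + numph U, where top U counts
-- the top-level holes, and everything the statement observes about U{Q}
-- is governed by top U:
--   * numap (U{Q}) = numap U + top U · numap Q;
--   * if top U = 0, U{Q} has the containment structure of U;
--   * if numap U = 0, the children of U{Q} are top U copies of those of Q.
-- Since an active process has no locations, CStr(a[Q]) ≈ CStr(a[U{Q}] ∥ A)
-- says exactly that the children of Q and of U{Q} agree as unordered
-- forests.  Agreeing forests have the same number of nodes, which equals
-- numap, giving the balance equation numap Q = numap U + top U · numap Q.

open import Defs
open import Data.Nat using (ℕ; zero; suc; _+_; _*_; _>_; z≤n; s≤s)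
open import Data.Nat.Properties
  using ( +-identityʳ; +-suc; +-assoc; *-zeroʳ; *-distribʳ-+; +-cancelˡ-≡
        ; m+n≡0⇒m≡0; m+n≡0⇒n≡0; +-commutativeSemigroup
        ; <-cmp; n<1⇒n≡0; n≮0; <⇒≤; ≤-reflexive)
open import Data.List using (List; []; _∷_; _++_; length)
open import Data.List.Properties using (++-identityʳ; ++-assoc)
open import Data.Product using (_×_; _,_; proj₁; proj₂)
open import Data.Sum using (_⊎_; inj₁; inj₂)
open import Data.Empty using (⊥-elim)
open import Relation.Binary using (tri<; tri≈; tri>)
open import Relation.Binary.PropositionalEquality
  using (_≡_; refl; sym; cong; cong₂; subst; subst₂; module ≡-Reasoning)
  renaming (trans to ≡-trans)
open import Function.Bundles using (_⇔_; mk⇔)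
open import Function.Construct.Composition using (_⇔-∘_)
open import Function.Construct.Identity using (⇔-id)
open import Data.Product.Function.NonDependent.Propositional using (_×-⇔_)
open import Algebra.Properties.CommutativeSemigroup +-commutativeSemigroup
  using (interchange; x∙yz≈y∙xz)

Forest : Set
Forest = List (Name × CTree)

mutual
  ≈T-refl : ∀ t → t ≈T t
  ≈T-refl (node cs) = node (≈L-refl cs)

  ≈L-refl : ∀ xs → xs ≈L xs
  ≈L-refl []             = []
  ≈L-refl ((a , t) ∷ xs) = cons refl (≈T-refl t) (≈L-refl xs)

≈T-trans : ∀ {s t u} → s ≈T t → t ≈T u → s ≈T u
≈T-trans (node p) (node q) = node (trans p q)

≈T-children : ∀ {xs ys} → node xs ≈T node ys → xs ≈L ys
≈T-children (node p) = p

length-≈L : ∀ {xs ys} → xs ≈L ys → length xs ≡ length ys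
length-≈L []           = refl
length-≈L (cons _ _ q) = cong suc (length-≈L q)
length-≈L swap         = refl
length-≈L (trans p q)  = ≡-trans (length-≈L p) (length-≈L q)

-- Two one-tree forests are equivalent only if the two trees are.  A
-- transitivity step passes through a forest of the same length, i.e.
-- again a one-tree forest.
singleton-≈L : ∀ {a b s t} → ((a , s) ∷ []) ≈L ((b , t) ∷ []) → s ≈T t
singleton-≈L (cons _ p _)                    = p
singleton-≈L (trans {ys = []} p _)           with () ← length-≈L p
singleton-≈L (trans {ys = _ ∷ []} p q)       = ≈T-trans (singleton-≈L p) (singleton-≈L q)
singleton-≈L (trans {ys = _ ∷ _ ∷ _} _ q)    with () ← length-≈L q

mutual
  treeSize : CTree → ℕ
  treeSize (node cs) = forestSize cs

  forestSize : Forest → ℕ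
  forestSize []             = 0
  forestSize ((a , t) ∷ xs) = suc (treeSize t + forestSize xs)

forestSize-++ : ∀ xs ys → forestSize (xs ++ ys) ≡ forestSize xs + forestSize ys
forestSize-++ []             ys = refl
forestSize-++ ((a , t) ∷ xs) ys =
  cong suc (≡-trans (cong (treeSize t +_) (forestSize-++ xs ys))
                    (sym (+-assoc (treeSize t) (forestSize xs) (forestSize ys))))

-- Exchanging the first two trees does not change the node count.
forestSize-swap : ∀ m n r → m + suc (n + r) ≡ n + suc (m + r)
forestSize-swap m n r = begin
  m + suc (n + r)   ≡⟨ +-suc m (n + r) ⟩
  suc (m + (n + r)) ≡⟨ cong suc (x∙yz≈y∙xz m n r) ⟩
  suc (n + (m + r)) ≡⟨ +-suc n (m + r) ⟨
  n + suc (m + r)   ∎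
  where open ≡-Reasoning

mutual
  treeSize-≈ : ∀ {s t} → s ≈T t → treeSize s ≡ treeSize t
  treeSize-≈ (node p) = forestSize-≈ p

  forestSize-≈ : ∀ {xs ys} → xs ≈L ys → forestSize xs ≡ forestSize ys
  forestSize-≈ []              = refl
  forestSize-≈ (cons refl p q) = cong suc (cong₂ _+_ (treeSize-≈ p) (forestSize-≈ q))
  forestSize-≈ (swap {x = _ , s} {y = _ , t} {xs}) =
    cong suc (forestSize-swap (treeSize s) (treeSize t) (forestSize xs))
  forestSize-≈ (trans p q)     = ≡-trans (forestSize-≈ p) (forestSize-≈ q)

forestSize-children : ∀ t → forestSize (children t) ≡ numap t
forestSize-children hole       = refl
forestSize-children (loc a t)  = cong suc (≡-trans (+-identityʳ _) (forestSize-children t))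
forestSize-children (par t u)  =
  ≡-trans (forestSize-++ (children t) (children u))
          (cong₂ _+_ (forestSize-children t) (forestSize-children u))
forestSize-children (repl π t) = refl
forestSize-children (sum xs)   = refl

children-numap≡0 : ∀ t → numap t ≡ 0 → children t ≡ []
children-numap≡0 t numap≡0 with children t | forestSize-children t
... | []    | _    = refl
... | _ ∷ _ | size with () ← ≡-trans size numap≡0

numap-≈ : ∀ s t → children s ≈L children t → numap s ≡ numap t
numap-≈ s t p = begin
  numap s                    ≡⟨ forestSize-children s ⟨
  forestSize (children s)    ≡⟨ forestSize-≈ p ⟩
  forestSize (children t)    ≡⟨ forestSize-children t ⟩
  numap t                    ∎
  where open ≡-Reasoning

children-active : ∀ A → children ⌜ A ⌝A ≡ []
children-active (apar A B) = cong₂ _++_ (children-active A) (children-active B)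
children-active (repl π A) = refl
children-active (sum xs)   = refl

located-≈ : ∀ a t u v → children v ≡ [] →
  CStr (loc a t) ≈T CStr (par (loc a u) v) ⇔ children t ≈L children u
located-≈ a t u v noLoc = mk⇔ to from
  where
  sides : Forest → Set
  sides rest = ((a , CStr t) ∷ []) ≈L ((a , CStr u) ∷ rest)

  to : CStr (loc a t) ≈T CStr (par (loc a u) v) → children t ≈L children u
  to p = ≈T-children (singleton-≈L (subst sides noLoc (≈T-children p)))

  from : children t ≈L children u → CStr (loc a t) ≈T CStr (par (loc a u) v)
  from p = node (subst sides (sym noLoc) (cons refl (node p) []))

mutual
  plug : Term → Term → Term
  plug hole       s = s
  plug (loc a t)  s = loc a (plug t s)
  plug (par t u)  s = par (plug t s) (plug u s)
  plug (repl π t) s = repl π (plug t s)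
  plug (sum xs)   s = sum (plug-list xs s)

  plug-list : List (Prefix × Term) → Term → List (Prefix × Term)
  plug-list []             s = []
  plug-list ((π , t) ∷ xs) s = (π , plug t s) ∷ plug-list xs s

mutual
  fill-plug : ∀ U Q → U ⟨ Q ⟩ ≡ plug ⌜ U ⌝U ⌜ Q ⌝P
  fill-plug hole       Q = refl
  fill-plug (ploc a U) Q = cong (loc a) (fill-plug U Q)
  fill-plug (ppar U V) Q = cong₂ par (fill-plug U Q) (fill-plug V Q)
  fill-plug (pact A)   Q = fillA-plug A Q

  fillA-plug : ∀ A Q → fillA A Q ≡ plug ⌜ A ⌝AU ⌜ Q ⌝P
  fillA-plug ahole      Q = refl
  fillA-plug (apar A B) Q = cong₂ par (fillA-plug A Q) (fillA-plug B Q)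
  fillA-plug (repl π A) Q = cong (repl π) (fillA-plug A Q)
  fillA-plug (sum xs)   Q = cong sum (fill-list-plug xs Q)

  fill-list-plug : ∀ xs Q → fill-list xs Q ≡ plug-list (embAU-list xs) ⌜ Q ⌝P
  fill-list-plug []             Q = refl
  fill-list-plug ((π , A) ∷ xs) Q = cong₂ _∷_ (cong (π ,_) (fillA-plug A Q)) (fill-list-plug xs Q)

-- The holes not guarded by a prefix: the ones that plugging reaches and
-- that contribute to the containment structure.
topHoles : Term → ℕ
topHoles hole       = 1
topHoles (loc a t)  = topHoles t
topHoles (par t u)  = topHoles t + topHoles u
topHoles (repl π t) = 0
topHoles (sum xs)   = 0

numholes-split : ∀ t → numholes t ≡ topHoles t + numph t
numholes-split hole       = refl
numholes-split (loc a t)  = numholes-split t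
numholes-split (par t u)  =
  ≡-trans (cong₂ _+_ (numholes-split t) (numholes-split u))
          (interchange (topHoles t) (numph t) (topHoles u) (numph u))
numholes-split (repl π t) = refl
numholes-split (sum xs)   = refl

numap-plug : ∀ t s → numap (plug t s) ≡ numap t + topHoles t * numap s
numap-plug hole       s = sym (+-identityʳ (numap s))
numap-plug (loc a t)  s = cong suc (numap-plug t s)
numap-plug (par t u)  s = begin
  numap (plug t s) + numap (plug u s)
    ≡⟨ cong₂ _+_ (numap-plug t s) (numap-plug u s) ⟩
  (numap t + topHoles t * numap s) + (numap u + topHoles u * numap s)
    ≡⟨ interchange (numap t) (topHoles t * numap s) (numap u) (topHoles u * numap s) ⟩
  (numap t + numap u) + (topHoles t * numap s + topHoles u * numap s)
    ≡⟨ cong (numap t + numap u +_) (*-distribʳ-+ (numap s) (topHoles t) (topHoles u)) ⟨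
  (numap t + numap u) + (topHoles t + topHoles u) * numap s
    ∎
  where open ≡-Reasoning
numap-plug (repl π t) s = refl
numap-plug (sum xs)   s = refl

children-plug-unreached : ∀ t s → topHoles t ≡ 0 → children (plug t s) ≡ children t
children-plug-unreached hole       s ()
children-plug-unreached (loc a t)  s top≡0 =
  cong (λ cs → (a , node cs) ∷ []) (children-plug-unreached t s top≡0)
children-plug-unreached (par t u)  s top≡0 =
  cong₂ _++_ (children-plug-unreached t s (m+n≡0⇒m≡0 (topHoles t) top≡0))
             (children-plug-unreached u s (m+n≡0⇒n≡0 (topHoles t) top≡0))
children-plug-unreached (repl π t) s _ = refl
children-plug-unreached (sum xs)   s _ = refl

copies : ℕ → Forest → Forest
copies zero    xs = []
copies (suc n) xs = xs ++ copies n xs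

copies-+ : ∀ m n xs → copies m xs ++ copies n xs ≡ copies (m + n) xs
copies-+ zero    n xs = refl
copies-+ (suc m) n xs = ≡-trans (++-assoc xs (copies m xs) (copies n xs))
                                (cong (xs ++_) (copies-+ m n xs))

children-plug-unlocated : ∀ t s → numap t ≡ 0 →
  children (plug t s) ≡ copies (topHoles t) (children s)
children-plug-unlocated hole       s _ = sym (++-identityʳ (children s))
children-plug-unlocated (loc a t)  s ()
children-plug-unlocated (par t u)  s numap≡0 =
  ≡-trans (cong₂ _++_ (children-plug-unlocated t s (m+n≡0⇒m≡0 (numap t) numap≡0))
                      (children-plug-unlocated u s (m+n≡0⇒n≡0 (numap t) numap≡0)))
          (copies-+ (topHoles t) (topHoles u) (children s))
children-plug-unlocated (repl π t) s _ = refl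
children-plug-unlocated (sum xs)   s _ = refl

-- Arithmetic of the balance equation  n = m + k·n  (n = numap s,
-- m = numap t, k = topHoles t, p = numph t, with k + p = numholes t).

absorb : ∀ k {m n} → n ≡ m + suc k * n → m + k * n ≡ 0
absorb k {m} {n} balance = sym (+-cancelˡ-≡ n 0 (m + k * n) (begin
  n + 0               ≡⟨ +-identityʳ n ⟩
  n                   ≡⟨ balance ⟩
  m + (n + k * n)     ≡⟨ x∙yz≈y∙xz m n (k * n) ⟩
  n + (m + k * n)     ∎))
  where open ≡-Reasoning

balance-unlocated : ∀ k p {m n} → n ≡ m + k * n → (p > 0 → n ≡ 0) → k + p > 0 → m ≡ 0
balance-unlocated zero    zero    _ _ ()
balance-unlocated zero    (suc p) {m} balance emptied _ =
  ≡-trans (sym (+-identityʳ m)) (≡-trans (sym balance) (emptied (s≤s z≤n)))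
balance-unlocated (suc k) p balance _ _ = m+n≡0⇒m≡0 _ (absorb k balance)

balance-emptied : ∀ k p {m n} → n ≡ m + k * n → (p > 0 → n ≡ 0) → k + p > 1 → n ≡ 0
balance-emptied k             (suc p) _ emptied _ = emptied (s≤s z≤n)
balance-emptied zero          zero    _ _ ()
balance-emptied (suc zero)    zero    _ _ (s≤s ())
balance-emptied (suc (suc k)) zero {m} {n} balance _ _ =
  m+n≡0⇒m≡0 n (m+n≡0⇒n≡0 m (absorb (suc k) {m} {n} balance))

module _ (t s : Term) where

  -- The left-hand side of the lemma, with the structural part already
  -- reduced to agreement of the children (see located-≈).
  Agreement : Set
  Agreement = children s ≈L children (plug t s) × (numph t > 0 → numap s ≡ 0)

  Cases : Set
  Cases = (numholes t ≡ 0 × CStr s ≈T CStr t)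
        ⊎ (numholes t ≡ 1 × numap t ≡ 0 × (numph t > 0 → numap s ≡ 0))
        ⊎ (numholes t > 1 × numap t ≡ 0 × numap s ≡ 0)

  no-holes : numholes t ≡ 0 → topHoles t ≡ 0 × numph t ≡ 0
  no-holes h≡0 = m+n≡0⇒m≡0 (topHoles t) split , m+n≡0⇒n≡0 (topHoles t) split
    where split = ≡-trans (sym (numholes-split t)) h≡0

  agree-unlocated : numap t ≡ 0 → numap s ≡ 0 → children s ≈L children (plug t s)
  agree-unlocated t≡0 s≡0 = subst₂ _≈L_ (sym (children-numap≡0 s s≡0))
                                        (sym (children-numap≡0 (plug t s) plugged≡0)) []
    where
    plugged≡0 : numap (plug t s) ≡ 0
    plugged≡0 = ≡-trans (numap-plug t s)
                        (cong₂ _+_ t≡0 (≡-trans (cong (topHoles t *_) s≡0) (*-zeroʳ (topHoles t))))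

  agree-single : topHoles t ≡ 1 → numap t ≡ 0 → children s ≈L children (plug t s)
  agree-single top≡1 t≡0 = subst (children s ≈L_) (sym plugged) (≈L-refl (children s))
    where
    plugged : children (plug t s) ≡ children s
    plugged = ≡-trans (children-plug-unlocated t s t≡0)
                      (≡-trans (cong (λ k → copies k (children s)) top≡1) (++-identityʳ (children s)))

  -- With exactly one hole, either it is at top level or s has no locations.
  agree-one-hole : numholes t ≡ 1 → numap t ≡ 0 → (numph t > 0 → numap s ≡ 0) →
    children s ≈L children (plug t s)
  agree-one-hole h≡1 t≡0 emptied with numph t | numholes-split t
  ... | zero  | split =
    agree-single (≡-trans (sym (+-identityʳ (topHoles t))) (≡-trans (sym split) h≡1)) t≡0
  ... | suc _ | _     = agree-unlocated t≡0 (emptied (s≤s z≤n))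

  -- Agreeing forests have equally many nodes, which is the balance equation.
  balance : children s ≈L children (plug t s) → numap s ≡ numap t + topHoles t * numap s
  balance E = ≡-trans (numap-≈ s (plug t s) E) (numap-plug t s)

  agreement-unlocated : Agreement → numholes t > 0 → numap t ≡ 0
  agreement-unlocated (E , emptied) h>0 =
    balance-unlocated (topHoles t) (numph t) (balance E) emptied (subst (_> 0) (numholes-split t) h>0)

  agreement-emptied : Agreement → numholes t > 1 → numap s ≡ 0
  agreement-emptied (E , emptied) h>1 =
    balance-emptied (topHoles t) (numph t) (balance E) emptied (subst (_> 1) (numholes-split t) h>1)

  agreement⇒cases : Agreement → Cases
  agreement⇒cases agree@(E , emptied) with <-cmp (numholes t) 1
  ... | tri< h<1 _ _ = inj₁ (h≡0 , node (subst (children s ≈L_) unreached E))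
    where
    h≡0 = n<1⇒n≡0 h<1
    unreached = children-plug-unreached t s (no-holes h≡0 .proj₁)
  ... | tri≈ _ h≡1 _ = inj₂ (inj₁ (h≡1 , agreement-unlocated agree (≤-reflexive (sym h≡1)) , emptied))
  ... | tri> _ _ h>1 = inj₂ (inj₂ (h>1 , agreement-unlocated agree (<⇒≤ h>1) , agreement-emptied agree h>1))

  cases⇒agreement : Cases → Agreement
  cases⇒agreement (inj₁ (h≡0 , node same)) =
    subst (children s ≈L_) (sym (children-plug-unreached t s (no-holes h≡0 .proj₁))) same ,
    λ p>0 → ⊥-elim (n≮0 (subst (_> 0) (no-holes h≡0 .proj₂) p>0))
  cases⇒agreement (inj₂ (inj₁ (h≡1 , t≡0 , emptied))) = agree-one-hole h≡1 t≡0 emptied , emptied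
  cases⇒agreement (inj₂ (inj₂ (_ , t≡0 , s≡0)))       = agree-unlocated t≡0 s≡0 , λ _ → s≡0

  characterisation : Agreement ⇔ Cases
  characterisation = mk⇔ agreement⇒cases cases⇒agreement

lemma2p18 : (Q : Proc) (a : Name) (U : Pat) (A : AProc) →
    ((CStr (loc a ⌜ Q ⌝P) ≈T CStr (par (loc a (U ⟨ Q ⟩)) ⌜ A ⌝A))
    × (numph ⌜ U ⌝U > 0 → numap ⌜ Q ⌝P ≡ 0))
    ⇔
    ((numholes ⌜ U ⌝U ≡ 0 × CStr ⌜ Q ⌝P ≈T CStr ⌜ U ⌝U)
    ⊎ (numholes ⌜ U ⌝U ≡ 1 × numap ⌜ U ⌝U ≡ 0 × (numph ⌜ U ⌝U > 0 → numap ⌜ Q ⌝P ≡ 0))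
    ⊎ (numholes ⌜ U ⌝U > 1 × numap ⌜ U ⌝U ≡ 0 × numap ⌜ Q ⌝P ≡ 0))
lemma2p18 Q a U A =
  characterisation ⌜ U ⌝U ⌜ Q ⌝P ⇔-∘ (located ×-⇔ ⇔-id (numph ⌜ U ⌝U > 0 → numap ⌜ Q ⌝P ≡ 0))
  where
  located : CStr (loc a ⌜ Q ⌝P) ≈T CStr (par (loc a (U ⟨ Q ⟩)) ⌜ A ⌝A)
          ⇔ children ⌜ Q ⌝P ≈L children (plug ⌜ U ⌝U ⌜ Q ⌝P)
  located = subst (λ F → CStr (loc a ⌜ Q ⌝P) ≈T CStr (par (loc a F) ⌜ A ⌝A)
                         ⇔ children ⌜ Q ⌝P ≈L children (plug ⌜ U ⌝U ⌜ Q ⌝P))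
                  (sym (fill-plug U Q))
                  (located-≈ a ⌜ Q ⌝P (plug ⌜ U ⌝U ⌜ Q ⌝P) ⌜ A ⌝A (children-active A))
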